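{- For $N\ge3$, the set $\Psi^N_{DC}$ of all $N$-tuples $(\psi_1,\dots,\psi_N)\in\Psi^N$ satisfying the Distinct Coordinates condition is dense in $\mathbb{R}^N$.
   Context: $\Psi$ is the set of Pythagorean ratios: $0$ together with all $\beta/\alpha$ where $\alpha,\beta,\gamma$ are nonzero integers with $\alpha^2+\beta^2=\gamma^2$. An $N$-tuple $(\psi_1,\dots,\psi_N)$ satisfies the Distinct Coordinates condition if: $\psi_1\ne\psi_2$, $\psi_1\ne\psi_N$, $\psi_2\ne\psi_N$; $\psi_{i-1}\ne\psi_{j-1}$ for all $4\le i<j\le N$; and for all $4\le j\le N$: $\psi_1\ne\psi_{j-1}$, $\psi_2\ne\psi_{j-1}$, $\psi_1+\psi_2\ne\psi_{j-1}+\psi_N$.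
   Formalization: Density is asserted only for approximating points with rational coordinates within rational distances ε > 0, rather than arbitrary points of ℝ^N. -}

module Defs where

open import Data.Nat as ℕ using (ℕ; zero; suc; _≤_; _<_; _<?_)
open import Data.Integer as ℤ using (ℤ; +_; +[1+_]; -[1+_])
open import Data.Rational using (ℚ; 0ℚ; _/_; _+_)
open import Data.Fin using (Fin; fromℕ<)
open import Data.Product using (Σ; ∃; _×_)
open import Data.Sum using (_⊎_)
open import Relation.Binary.PropositionalEquality using (_≡_; _≢_)
open import Relation.Nullary using (yes; no)

_÷ℤ_ : ℤ → (α : ℤ) → .{{ℤ.NonZero α}} → ℚ
β ÷ℤ +[1+ n ] = β / suc n
β ÷ℤ -[1+ n ] = (ℤ.- β) / suc n

Ψ : ℚ → Set
Ψ ψ = ψ ≡ 0ℚ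
    ⊎ Σ ℤ λ α → Σ ℤ λ β → Σ ℤ λ γ →
        Σ (ℤ.NonZero α) λ nzα → ℤ.NonZero β × ℤ.NonZero γ
        × (α ℤ.* α ℤ.+ β ℤ.* β ≡ γ ℤ.* γ)
        × (ψ ≡ _÷ℤ_ β α {{nzα}})

-- 1-based coordinate access of an N-tuple ψ = (ψ₁,…,ψ_N) given as Fin N → ℚ.
-- at ψ k = ψ_k for 1 ≤ k ≤ N (out-of-range indices give 0, never used below).
at : ∀ {N} → (Fin N → ℚ) → ℕ → ℚ
at ψ zero = 0ℚ
at {N} ψ (suc k) with k <? N
... | yes p = ψ (fromℕ< p)
... | no _  = 0ℚ

DC : ∀ {N} → (Fin N → ℚ) → Set
DC {N} ψ =
    (at ψ 1 ≢ at ψ 2) × (at ψ 1 ≢ at ψ N) × (at ψ 2 ≢ at ψ N)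
  × (∀ i j → 4 ≤ i → i < j → j ≤ N → at ψ (i ℕ.∸ 1) ≢ at ψ (j ℕ.∸ 1))
  × (∀ j → 4 ≤ j → j ≤ N →
        (at ψ 1 ≢ at ψ (j ℕ.∸ 1))
      × (at ψ 2 ≢ at ψ (j ℕ.∸ 1))
      × (at ψ 1 + at ψ 2 ≢ at ψ (j ℕ.∸ 1) + at ψ N))

InΨDC : ∀ {N} → (Fin N → ℚ) → Set
InΨDC ψ = (∀ i → Ψ (ψ i)) × DC ψ

{-# OPTIONS --safe #-}
module Submission where

open import Defs
open import Data.Nat using (ℕ; _≤_)
open import Data.Fin using (Fin)
open import Data.Rational using (ℚ; 0ℚ; _<_; _-_; ∣_∣)
open import Data.Product using (Σ; _×_)

open import Data.Empty using (⊥-elim)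
open import Data.Fin using (toℕ; fromℕ<)
import Data.Fin.Properties as Finₚ
open import Data.Integer as ℤ using (+_; +[1+_]; -[1+_])
import Data.Integer.Properties as ℤₚ
open import Data.List using (List; []; _∷_; cartesianProductWith)
open import Data.List.Membership.Propositional using (_∈_)
open import Data.List.Membership.Propositional.Properties using (∈-cartesianProductWith⁺)
open import Data.List.Relation.Unary.All as All using (All; _∷_)
open import Data.List.Relation.Unary.Any using (here; there)
open import Data.Nat as ℕ using (zero; suc; z≤n; s≤s)
import Data.Nat.Properties as ℕₚ
open import Data.Nat.Tactic.RingSolver using (solve-∀)
open import Data.Product using (_,_; proj₁; proj₂)
open import Data.Rational as ℚ using (_/_; _+_; -_; mkℚ; *≤*)
import Data.Rational.Properties as ℚₚ
open import Algebra.Properties.AbelianGroup ℚₚ.+-0-abelianGroup using (xyx⁻¹≈y; ⁻¹-involutive)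
open import Data.Rational.Unnormalised as ℚᵘ using (mkℚᵘ)
import Data.Rational.Unnormalised.Properties as ℚᵘₚ
open import Data.Sum using (inj₁; inj₂)
open import Function using (_∘_)
open import Relation.Binary.PropositionalEquality
  using (_≡_; _≢_; refl; sym; trans; cong; cong₂; subst; subst₂; module ≡-Reasoning)
open import Relation.Nullary using (yes; no)

-- The leg ratios (v² − u²)/(2uv) of Euclid's triples, for fixed u and v = u, u + 1, …, start
-- at 0, grow without bound and increase by less than 1/u per step, so for large u they meet
-- every interval of nonnegative rationals; as Ψ also contains 0 and is closed under negation,
-- it is dense, and stays dense after removing finitely many points. Hence the coordinates can
-- be chosen greedily, ψₖ within ε of qₖ and different from every ψₐ + ψ_b − ψ_c with
-- a, b, c < k. The Distinct Coordinates condition follows: distinctness is the case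
-- a = b = c, and ψ₁ + ψ₂ = ψⱼ + ψ_N would make ψ_N = ψ₁ + ψ₂ − ψⱼ.

private variable
  a b i j k : ℕ
  lo hi : ℚ

fraction-≤ : ∀ a b c d .{{_ : ℕ.NonZero b}} .{{_ : ℕ.NonZero d}} →
             a ℕ.* d ≤ c ℕ.* b → + a / b ℚ.≤ + c / d
fraction-≤ a (suc b) c (suc d) ad≤cb =
  ℚₚ.toℚᵘ-cancel-≤
    (ℚᵘₚ.≤-respˡ-≃ (ℚᵘₚ.≃-sym (ℚₚ.toℚᵘ-fromℚᵘ (mkℚᵘ (+ a) b)))
      (ℚᵘₚ.≤-respʳ-≃ (ℚᵘₚ.≃-sym (ℚₚ.toℚᵘ-fromℚᵘ (mkℚᵘ (+ c) d)))
        (ℚᵘ.*≤* (subst₂ ℤ._≤_ (ℤₚ.pos-* a (suc d)) (ℤₚ.pos-* c (suc b)) (ℤ.+≤+ ad≤cb)))))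

fraction-< : ∀ a b c d .{{_ : ℕ.NonZero b}} .{{_ : ℕ.NonZero d}} →
             a ℕ.* d ℕ.< c ℕ.* b → + a / b < + c / d
fraction-< a (suc b) c (suc d) ad<cb =
  ℚₚ.toℚᵘ-cancel-<
    (ℚᵘₚ.<-respˡ-≃ (ℚᵘₚ.≃-sym (ℚₚ.toℚᵘ-fromℚᵘ (mkℚᵘ (+ a) b)))
      (ℚᵘₚ.<-respʳ-≃ (ℚᵘₚ.≃-sym (ℚₚ.toℚᵘ-fromℚᵘ (mkℚᵘ (+ c) d)))
        (ℚᵘ.*<* (subst₂ ℤ._<_ (ℤₚ.pos-* a (suc d)) (ℤₚ.pos-* c (suc b)) (ℤ.+<+ ad<cb)))))

fraction-<⁻¹ : ∀ a b c d .{{_ : ℕ.NonZero b}} .{{_ : ℕ.NonZero d}} →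
               + a / b < + c / d → a ℕ.* d ℕ.< c ℕ.* b
fraction-<⁻¹ a (suc b) c (suc d) a/b<c/d
  with ℚᵘₚ.<-respˡ-≃ (ℚₚ.toℚᵘ-fromℚᵘ (mkℚᵘ (+ a) b))
         (ℚᵘₚ.<-respʳ-≃ (ℚₚ.toℚᵘ-fromℚᵘ (mkℚᵘ (+ c) d)) (ℚₚ.toℚᵘ-mono-< a/b<c/d))
... | ℚᵘ.*<* ad<cb =
  ℤₚ.drop‿+<+ (subst₂ ℤ._<_ (sym (ℤₚ.pos-* a (suc d))) (sym (ℤₚ.pos-* c (suc b))) ad<cb)

fraction-+ : ∀ a b c d →
             + a / suc b + + c / suc d ≡ + (a ℕ.* suc d ℕ.+ c ℕ.* suc b) / (suc b ℕ.* suc d)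
fraction-+ a b c d = ℚₚ.toℚᵘ-injective (begin-equality
    ℚ.toℚᵘ (+ a / suc b + + c / suc d)
  ≃⟨ ℚₚ.toℚᵘ-homo-+ (+ a / suc b) (+ c / suc d) ⟩
    ℚ.toℚᵘ (+ a / suc b) ℚᵘ.+ ℚ.toℚᵘ (+ c / suc d)
  ≃⟨ ℚᵘₚ.+-cong (ℚₚ.toℚᵘ-fromℚᵘ (mkℚᵘ (+ a) b)) (ℚₚ.toℚᵘ-fromℚᵘ (mkℚᵘ (+ c) d)) ⟩
    mkℚᵘ (+ a) b ℚᵘ.+ mkℚᵘ (+ c) d
  ≃⟨ ℚᵘ.*≡* (cong (ℤ._* +[1+ d ℕ.+ b ℕ.* suc d ]) numerator) ⟩
    mkℚᵘ (+ (a ℕ.* suc d ℕ.+ c ℕ.* suc b)) (d ℕ.+ b ℕ.* suc d)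
  ≃⟨ ℚᵘₚ.≃-sym (ℚₚ.toℚᵘ-fromℚᵘ _) ⟩
    ℚ.toℚᵘ (+ (a ℕ.* suc d ℕ.+ c ℕ.* suc b) / (suc b ℕ.* suc d))
  ∎)
  where
  open ℚᵘₚ.≤-Reasoning
  numerator : + a ℤ.* + suc d ℤ.+ + c ℤ.* + suc b ≡ + (a ℕ.* suc d ℕ.+ c ℕ.* suc b)
  numerator = trans (cong₂ ℤ._+_ (sym (ℤₚ.pos-* a (suc d))) (sym (ℤₚ.pos-* c (suc b))))
                    (sym (ℤₚ.pos-+ (a ℕ.* suc d) (c ℕ.* suc b)))

nonNegative-fraction : ∀ p → 0ℚ ℚ.≤ p → Σ ℕ λ a → Σ ℕ λ b → p ≡ + a / suc b
nonNegative-fraction p@(mkℚ (+ a) b _) _ = a , b , sym (ℚₚ.↥p/↧p≡p p)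
nonNegative-fraction (mkℚ -[1+ _ ] _ _) (*≤* ())

fraction-gap : ∀ a b c d → + a / suc b < + c / suc d →
               + a / suc b + + 1 / (suc b ℕ.* suc d) ℚ.≤ + c / suc d
fraction-gap a b c d a/b<c/d =
  subst (ℚ._≤ + c / suc d) (sym (fraction-+ a b 1 (d ℕ.+ b ℕ.* suc d)))
    (fraction-≤ (a ℕ.* bd ℕ.+ 1 ℕ.* suc b) (suc b ℕ.* bd) c (suc d)
      (subst₂ _≤_ (sym (left-cross a b d)) (sym (right-cross b c d))
        (ℕₚ.*-monoʳ-≤ bd (fraction-<⁻¹ a (suc b) c (suc d) a/b<c/d))))
  where
  bd = suc b ℕ.* suc d
  left-cross : ∀ a b d → (a ℕ.* (suc b ℕ.* suc d) ℕ.+ 1 ℕ.* suc b) ℕ.* suc d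
                         ≡ suc b ℕ.* suc d ℕ.* suc (a ℕ.* suc d)
  left-cross = solve-∀
  right-cross : ∀ b c d → c ℕ.* (suc b ℕ.* (suc b ℕ.* suc d)) ≡ suc b ℕ.* suc d ℕ.* (c ℕ.* suc b)
  right-cross = solve-∀

pythagorean-Ψ : ∀ a b c .{{_ : ℕ.NonZero a}} .{{_ : ℕ.NonZero b}} .{{_ : ℕ.NonZero c}} →
                a ℕ.* a ℕ.+ b ℕ.* b ≡ c ℕ.* c → Ψ (+ b / a) × Ψ (- (+ b / a))
pythagorean-Ψ (suc a) (suc b) (suc c) a²+b²≡c² =
  inj₂ (+[1+ a ] , +[1+ b ] , +[1+ c ] , _ , _ , _ , cong +_ a²+b²≡c² , refl) ,
  inj₂ (+[1+ a ] , -[1+ b ] , +[1+ c ] , _ , _ , _ , cong +_ a²+b²≡c² , refl)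

-- (v² − u²) / (2uv) for v = u + t, the leg ratio of Euclid's triple (2uv, v² − u², u² + v²).
pythagoreanRatio : (u : ℕ) .{{_ : ℕ.NonZero u}} → ℕ → ℚ
pythagoreanRatio u@(suc _) t = + (t ℕ.* (2 ℕ.* u ℕ.+ t)) / (2 ℕ.* u ℕ.* (u ℕ.+ t))

pythagoreanRatio-Ψ : ∀ u .{{_ : ℕ.NonZero u}} t →
                     Ψ (pythagoreanRatio u (suc t)) × Ψ (- pythagoreanRatio u (suc t))
pythagoreanRatio-Ψ u@(suc _) t =
  pythagorean-Ψ (2 ℕ.* u ℕ.* (u ℕ.+ suc t)) (suc t ℕ.* (2 ℕ.* u ℕ.+ suc t))
                (u ℕ.* u ℕ.+ (u ℕ.+ suc t) ℕ.* (u ℕ.+ suc t)) (euclid u (suc t))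
  where
  euclid : ∀ u t → let α = 2 ℕ.* u ℕ.* (u ℕ.+ t); β = t ℕ.* (2 ℕ.* u ℕ.+ t)
                       γ = u ℕ.* u ℕ.+ (u ℕ.+ t) ℕ.* (u ℕ.+ t)
                   in α ℕ.* α ℕ.+ β ℕ.* β ≡ γ ℕ.* γ
  euclid = solve-∀

pythagoreanRatio-step : ∀ u .{{_ : ℕ.NonZero u}} t →
                        pythagoreanRatio u (suc t) < pythagoreanRatio u t + + 1 / u
pythagoreanRatio-step u@(suc m) t =
  subst (pythagoreanRatio u (suc t) <_) (sym (fraction-+ β (ℕ.pred α) 1 m))
    (fraction-< β′ α′ (β ℕ.* u ℕ.+ 1 ℕ.* α) (α ℕ.* u)
      (subst (β′ ℕ.* (α ℕ.* u) ℕ.<_) (sym (cross u t)) (ℕₚ.m<m+n _ (s≤s z≤n))))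
  where
  α = 2 ℕ.* u ℕ.* (u ℕ.+ t)
  β = t ℕ.* (2 ℕ.* u ℕ.+ t)
  α′ = 2 ℕ.* u ℕ.* (u ℕ.+ suc t)
  β′ = suc t ℕ.* (2 ℕ.* u ℕ.+ suc t)
  cross : ∀ u t → let α = 2 ℕ.* u ℕ.* (u ℕ.+ t); β = t ℕ.* (2 ℕ.* u ℕ.+ t)
                      α′ = 2 ℕ.* u ℕ.* (u ℕ.+ suc t); β′ = suc t ℕ.* (2 ℕ.* u ℕ.+ suc t)
                  in (β ℕ.* u ℕ.+ 1 ℕ.* α) ℕ.* α′
                     ≡ β′ ℕ.* (α ℕ.* u) ℕ.+ 2 ℕ.* u ℕ.* u ℕ.* (u ℕ.+ t ℕ.+ 2 ℕ.* u ℕ.* t ℕ.+ t ℕ.* t)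
  cross = solve-∀

pythagoreanRatio-unbounded : ∀ u .{{_ : ℕ.NonZero u}} a b →
                             + a / suc b < pythagoreanRatio u (2 ℕ.* u ℕ.* suc a)
pythagoreanRatio-unbounded u@(suc _) a b =
  fraction-< a (suc b) (T ℕ.* (2 ℕ.* u ℕ.+ T)) (2 ℕ.* u ℕ.* (u ℕ.+ T))
    (subst (a ℕ.* (2 ℕ.* u ℕ.* (u ℕ.+ T)) ℕ.<_) (sym (cross u a b)) (ℕₚ.m<m+n _ (s≤s z≤n)))
  where
  T = 2 ℕ.* u ℕ.* suc a
  cross : ∀ u a b → let T = 2 ℕ.* u ℕ.* suc a in
          T ℕ.* (2 ℕ.* u ℕ.+ T) ℕ.* suc b
          ≡ a ℕ.* (2 ℕ.* u ℕ.* (u ℕ.+ T))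
            ℕ.+ (2 ℕ.* u ℕ.* (u ℕ.+ T) ℕ.+ T ℕ.* u ℕ.+ T ℕ.* (2 ℕ.* u ℕ.+ T) ℕ.* b)
  cross = solve-∀

crossing : ∀ (f : ℕ → ℚ) T → f 0 ℚ.≤ lo → lo < f T → Σ ℕ λ t → f t ℚ.≤ lo × lo < f (suc t)
crossing f zero    f0≤lo lo<f0 = ⊥-elim (ℚₚ.<-irrefl refl (ℚₚ.<-≤-trans lo<f0 f0≤lo))
crossing {lo} f (suc T) f0≤lo lo<fT+1 with lo ℚₚ.<? f T
... | yes lo<fT = crossing f T f0≤lo lo<fT
... | no  lo≮fT = T , ℚₚ.≮⇒≥ lo≮fT , lo<fT+1

small-steps-enter-interval : ∀ (f : ℕ → ℚ) {δ} T → (∀ t → f (suc t) < f t + δ) →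
                             f 0 ℚ.≤ lo → lo + δ ℚ.≤ hi → lo < f T →
                             Σ ℕ λ t → lo < f (suc t) × f (suc t) < hi
small-steps-enter-interval {lo} {hi} f {δ} T step f0≤lo lo+δ≤hi lo<fT =
  let t , ft≤lo , lo<ft+1 = crossing f T f0≤lo lo<fT
  in t , lo<ft+1 , ℚₚ.<-≤-trans (step t) (ℚₚ.≤-trans (ℚₚ.+-monoˡ-≤ δ ft≤lo) lo+δ≤hi)

Ψ-dense-nonNegative : 0ℚ ℚ.≤ lo → lo < hi → Σ ℚ λ ψ → (Ψ ψ × Ψ (- ψ)) × lo < ψ × ψ < hi
Ψ-dense-nonNegative {lo} {hi} 0≤lo lo<hi
  with nonNegative-fraction lo 0≤lo | nonNegative-fraction hi (ℚₚ.≤-trans 0≤lo (ℚₚ.<⇒≤ lo<hi))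
... | a , b , refl | c , d , refl =
  let t , lo<ψ , ψ<hi = small-steps-enter-interval (pythagoreanRatio u) (2 ℕ.* u ℕ.* suc a)
                          (pythagoreanRatio-step u) start≤lo (fraction-gap a b c d lo<hi)
                          (pythagoreanRatio-unbounded u a b)
  in pythagoreanRatio u (suc t) , pythagoreanRatio-Ψ u t , lo<ψ , ψ<hi
  where
  u = suc b ℕ.* suc d
  start≤lo : pythagoreanRatio u 0 ℚ.≤ + a / suc b
  start≤lo = fraction-≤ 0 (2 ℕ.* u ℕ.* (u ℕ.+ 0)) a (suc b) z≤n

Ψ-dense : lo < hi → Σ ℚ λ ψ → Ψ ψ × lo < ψ × ψ < hi
Ψ-dense {lo} {hi} lo<hi with lo ℚₚ.<? 0ℚ | 0ℚ ℚₚ.<? hi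
... | yes lo<0 | yes 0<hi = 0ℚ , inj₁ refl , lo<0 , 0<hi
... | no lo≮0 | _ =
  let ψ , (ψ∈Ψ , _) , lo<ψ , ψ<hi = Ψ-dense-nonNegative (ℚₚ.≮⇒≥ lo≮0) lo<hi
  in ψ , ψ∈Ψ , lo<ψ , ψ<hi
... | yes _ | no 0≮hi =
  let ψ , (_ , -ψ∈Ψ) , -hi<ψ , ψ<-lo = Ψ-dense-nonNegative (ℚₚ.neg-antimono-≤ (ℚₚ.≮⇒≥ 0≮hi))
                                                           (ℚₚ.neg-antimono-< lo<hi)
  in - ψ , -ψ∈Ψ , subst (_< - ψ) (⁻¹-involutive lo) (ℚₚ.neg-antimono-< ψ<-lo)
               , subst (- ψ <_) (⁻¹-involutive hi) (ℚₚ.neg-antimono-< -hi<ψ)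

subinterval-avoiding : ∀ f → lo < hi →
                       Σ ℚ λ hi′ → lo < hi′ × hi′ ℚ.≤ hi × (∀ {x} → lo < x → x < hi′ → x ≢ f)
subinterval-avoiding {lo} {hi} f lo<hi with lo ℚₚ.<? f | f ℚₚ.<? hi
... | yes lo<f | yes f<hi = f , lo<f , ℚₚ.<⇒≤ f<hi , λ _ → ℚₚ.<⇒≢
... | no lo≮f | _ = hi , lo<hi , ℚₚ.≤-refl , λ lo<x _ x≡f → lo≮f (subst (lo <_) x≡f lo<x)
... | yes _ | no f≮hi = hi , lo<hi , ℚₚ.≤-refl , λ _ x<hi x≡f → f≮hi (subst (_< hi) x≡f x<hi)

Ψ-dense-avoiding : lo < hi → (F : List ℚ) → Σ ℚ λ ψ → Ψ ψ × lo < ψ × ψ < hi × All (ψ ≢_) F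
Ψ-dense-avoiding lo<hi [] =
  let ψ , ψ∈Ψ , lo<ψ , ψ<hi = Ψ-dense lo<hi in ψ , ψ∈Ψ , lo<ψ , ψ<hi , All.[]
Ψ-dense-avoiding lo<hi (f ∷ F) =
  let hi′ , lo<hi′ , hi′≤hi , f∉ = subinterval-avoiding f lo<hi
      ψ , ψ∈Ψ , lo<ψ , ψ<hi′ , ψ∉F = Ψ-dense-avoiding lo<hi′ F
  in ψ , ψ∈Ψ , lo<ψ , ℚₚ.<-≤-trans ψ<hi′ hi′≤hi , f∉ lo<ψ ψ<hi′ ∷ ψ∉F

q<x<q+ε⇒∣x-q∣<ε : ∀ {q ε x} → q < x → x < q + ε → ∣ x - q ∣ < ε
q<x<q+ε⇒∣x-q∣<ε {q} {ε} {x} q<x x<q+ε =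
  subst₂ _<_ (sym (ℚₚ.0≤p⇒∣p∣≡p 0≤x-q)) (xyx⁻¹≈y q ε) (ℚₚ.+-monoˡ-< (- q) x<q+ε)
  where
  0≤x-q : 0ℚ ℚ.≤ x - q
  0≤x-q = subst (ℚ._≤ x - q) (ℚₚ.+-inverseʳ q) (ℚₚ.+-monoˡ-≤ (- q) (ℚₚ.<⇒≤ q<x))

Ψ-near-avoiding : ∀ q {ε} → 0ℚ < ε → (F : List ℚ) → Σ ℚ λ ψ → Ψ ψ × ∣ ψ - q ∣ < ε × All (ψ ≢_) F
Ψ-near-avoiding q {ε} 0<ε F =
  let ψ , ψ∈Ψ , q<ψ , ψ<q+ε , ψ∉F = Ψ-dense-avoiding q<q+ε F
  in ψ , ψ∈Ψ , q<x<q+ε⇒∣x-q∣<ε q<ψ ψ<q+ε , ψ∉F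
  where
  q<q+ε : q < q + ε
  q<q+ε = subst (_< q + ε) (ℚₚ.+-identityʳ q) (ℚₚ.+-monoʳ-< q 0<ε)

sumDifferences : List ℚ → List ℚ
sumDifferences xs = cartesianProductWith _-_ (cartesianProductWith _+_ xs xs) xs

∈-sumDifferences : ∀ {x y z xs} → x ∈ xs → y ∈ xs → z ∈ xs → x + y - z ∈ sumDifferences xs
∈-sumDifferences x∈xs y∈xs z∈xs =
  ∈-cartesianProductWith⁺ _-_ (∈-cartesianProductWith⁺ _+_ x∈xs y∈xs) z∈xs

AvoidsEarlierSumDifferences : (ℕ → ℚ) → Set
AvoidsEarlierSumDifferences s = ∀ {a b c k} → a ℕ.< k → b ℕ.< k → c ℕ.< k → s k ≢ s a + s b - s c

module _ {s : ℕ → ℚ} (avoids : AvoidsEarlierSumDifferences s) where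

  avoids⇒distinct : i ℕ.< k → s i ≢ s k
  avoids⇒distinct {i = i} i<k si≡sk =
    avoids i<k i<k i<k (trans (sym si≡sk) (sym (xyx⁻¹≈y (s i) (s i))))

  avoids⇒sums-distinct : a ℕ.< k → b ℕ.< k → j ℕ.< k → s a + s b ≢ s j + s k
  avoids⇒sums-distinct {a = a} {k = k} {b = b} {j = j} a<k b<k j<k sa+sb≡sj+sk =
    avoids a<k b<k j<k (begin
      s k              ≡⟨ xyx⁻¹≈y (s j) (s k) ⟨
      s j + s k - s j  ≡⟨ cong (_- s j) sa+sb≡sj+sk ⟨
      s a + s b - s j  ∎)
    where open ≡-Reasoning

greedy-Ψ-sequence : (q : ℕ → ℚ) → ∀ {ε} → 0ℚ < ε →
                    Σ (ℕ → ℚ) λ s → (∀ k → Ψ (s k)) × (∀ k → ∣ s k - q k ∣ < ε)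
                                    × AvoidsEarlierSumDifferences s
greedy-Ψ-sequence q {ε} 0<ε = s , proj₁ ∘ chosen , proj₁ ∘ proj₂ ∘ chosen , avoids
  where
  s : ℕ → ℚ
  earlier : ℕ → List ℚ
  s k = proj₁ (Ψ-near-avoiding (q k) 0<ε (sumDifferences (earlier k)))
  earlier zero    = []
  earlier (suc k) = s k ∷ earlier k

  chosen : ∀ k → Ψ (s k) × ∣ s k - q k ∣ < ε × All (s k ≢_) (sumDifferences (earlier k))
  chosen k = proj₂ (Ψ-near-avoiding (q k) 0<ε (sumDifferences (earlier k)))

  ∈-earlier : i ℕ.< k → s i ∈ earlier k
  ∈-earlier {i} {suc k} (s≤s i≤k) with ℕₚ.m≤n⇒m<n∨m≡n i≤k
  ... | inj₁ i<k  = there (∈-earlier i<k)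
  ... | inj₂ refl = here refl

  avoids : AvoidsEarlierSumDifferences s
  avoids {k = k} a<k b<k c<k =
    All.lookup (proj₂ (proj₂ (chosen k)))
               (∈-sumDifferences (∈-earlier a<k) (∈-earlier b<k) (∈-earlier c<k))

at-suc : ∀ {N} (f : Fin N → ℚ) (k<N : k ℕ.< N) → at f (suc k) ≡ f (fromℕ< k<N)
at-suc {k} {N} f k<N with k ℕ.<? N
... | yes _   = refl
... | no k≮N = ⊥-elim (k≮N k<N)

at-toℕ : ∀ {N} (f : Fin N → ℚ) i → at f (suc (toℕ i)) ≡ f i
at-toℕ f i = trans (at-suc f (Finₚ.toℕ<n i)) (cong f (Finₚ.fromℕ<-toℕ i _))

at-∘toℕ : ∀ {N} (s : ℕ → ℚ) → k ℕ.< N → at {N} (s ∘ toℕ) (suc k) ≡ s k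
at-∘toℕ s k<N = trans (at-suc (s ∘ toℕ) k<N) (cong s (Finₚ.toℕ-fromℕ< k<N))

avoids⇒DC : ∀ {N s} → 3 ≤ N → AvoidsEarlierSumDifferences s → DC {N} (s ∘ toℕ)
avoids⇒DC {suc K@(suc (suc _))} {s} (s≤s (s≤s (s≤s z≤n))) avoids =
  distinct (s≤s z≤n) (ℕₚ.<-trans 1<K K<N) , distinct 0<K K<N , distinct 1<K K<N ,
  later-distinct , later-conditions
  where
  ψ = s ∘ toℕ
  0<K : 0 ℕ.< K
  0<K = s≤s z≤n
  1<K : 1 ℕ.< K
  1<K = s≤s (s≤s z≤n)
  K<N : K ℕ.< suc K
  K<N = ℕₚ.n<1+n K

  at-ψ : k ℕ.< suc K → at ψ (suc k) ≡ s k
  at-ψ = at-∘toℕ s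

  distinct : i ℕ.< k → k ℕ.< suc K → at ψ (suc i) ≢ at ψ (suc k)
  distinct i<k k<N ψi≡ψk = avoids⇒distinct avoids i<k
    (trans (sym (at-ψ (ℕₚ.<-trans i<k k<N))) (trans ψi≡ψk (at-ψ k<N)))

  sums-distinct : a ℕ.< K → b ℕ.< K → j ℕ.< K →
                  at ψ (suc a) + at ψ (suc b) ≢ at ψ (suc j) + at ψ (suc K)
  sums-distinct {a} {b} {j} a<K b<K j<K ψa+ψb≡ψj+ψK =
    avoids⇒sums-distinct avoids a<K b<K j<K (begin
      s a + s b                    ≡⟨ cong₂ _+_ (at-ψ (ℕₚ.<-trans a<K K<N)) (at-ψ (ℕₚ.<-trans b<K K<N)) ⟨
      at ψ (suc a) + at ψ (suc b)  ≡⟨ ψa+ψb≡ψj+ψK ⟩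
      at ψ (suc j) + at ψ (suc K)  ≡⟨ cong₂ _+_ (at-ψ (ℕₚ.<-trans j<K K<N)) (at-ψ K<N) ⟩
      s j + s K                    ∎)
    where open ≡-Reasoning

  later-distinct : ∀ i j → 4 ≤ i → i ℕ.< j → j ≤ suc K → at ψ (i ℕ.∸ 1) ≢ at ψ (j ℕ.∸ 1)
  later-distinct (suc (suc i)) (suc (suc j)) (s≤s (s≤s _)) (s≤s (s≤s i<j)) (s≤s j<K) =
    distinct i<j (ℕₚ.<-trans j<K K<N)

  later-conditions : ∀ j → 4 ≤ j → j ≤ suc K →
                     (at ψ 1 ≢ at ψ (j ℕ.∸ 1)) × (at ψ 2 ≢ at ψ (j ℕ.∸ 1))
                     × (at ψ 1 + at ψ 2 ≢ at ψ (j ℕ.∸ 1) + at ψ (suc K))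
  later-conditions (suc (suc j@(suc (suc _)))) (s≤s (s≤s (s≤s (s≤s z≤n)))) (s≤s j<K) =
    distinct (s≤s z≤n) j<N , distinct (s≤s (s≤s z≤n)) j<N , sums-distinct 0<K 1<K j<K
    where
    j<N = ℕₚ.<-trans j<K K<N

lemma4p3 : (N : ℕ) → 3 ≤ N → (q : Fin N → ℚ) → (ε : ℚ) → 0ℚ < ε →
    Σ (Fin N → ℚ) λ ψ → InΨDC ψ × (∀ i → ∣ ψ i - q i ∣ < ε)
lemma4p3 N 3≤N q ε 0<ε =
  let s , s∈Ψ , s≈q , avoids = greedy-Ψ-sequence (λ k → at q (suc k)) 0<ε
  in s ∘ toℕ , (s∈Ψ ∘ toℕ , avoids⇒DC 3≤N avoids) ,
     λ i → subst (λ qᵢ → ∣ s (toℕ i) - qᵢ ∣ < ε) (at-toℕ q i) (s≈q (toℕ i))
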